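{- Let $\mathbf{M}$ be an $m\times n$ interval matrix with entries $\mathbf{m}_{ij}$. If for every row $i$ the intersection $\bigcap_{j=1}^n\mathbf{m}_{ij}$ is nonempty, or for every column $j$ the intersection $\bigcap_{i=1}^m\mathbf{m}_{ij}$ is nonempty, then $\mathbf{M}$ has the weak Monge property.
   Context: An interval matrix $\mathbf{M}=[\underline{M},\overline{M}]$ with real $m\times n$ matrices $\underline{M}\le\overline{M}$ is the set $\{A\in\mathbb{R}^{m\times n}:\underline{M}\le A\le\overline{M}\}$ (entrywise), with entries $\mathbf{m}_{ij}=[\underline{m}_{ij},\overline{m}_{ij}]$. A real matrix $A$ is Monge if $a_{ij}+a_{k\ell}\le a_{i\ell}+a_{kj}$ for all $i<k$, $j<\ell$. $\mathbf{M}$ has the weak Monge property if it contains a Monge matrix. -}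

module Defs where

open import Level using (Level; suc; _⊔_)
open import Data.Nat using (ℕ)
open import Data.Fin using (Fin; _<_)
open import Data.Product using (Σ; ∃; _×_)
open import Data.Sum using (_⊎_)
open import Relation.Binary.PropositionalEquality using (_≡_)
open import Relation.Binary.Structures using (IsTotalOrder)
open import Algebra.Structures using (IsAbelianGroup)

-- A totally ordered abelian group (translation-invariant total order).
-- The real numbers (ℝ, +, ≤) are an instance; agda-stdlib has no reals,
-- so the statement is made for every such structure.
record OrderedAbelianGroup (c ℓ : Level) : Set (suc (c ⊔ ℓ)) where
  field
    Carrier        : Set c
    _+_            : Carrier → Carrier → Carrier
    0#             : Carrier
    -_             : Carrier → Carrier
    _≤_            : Carrier → Carrier → Set ℓ
    isAbelianGroup : IsAbelianGroup _≡_ _+_ 0# -_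
    isTotalOrder   : IsTotalOrder _≡_ _≤_
    +-mono-≤       : ∀ a b c → a ≤ b → (a + c) ≤ (b + c)

module _ {c ℓ} (G : OrderedAbelianGroup c ℓ) where
  open OrderedAbelianGroup G

  Matrix : ℕ → ℕ → Set c
  Matrix m n = Fin m → Fin n → Carrier

  record IntervalMatrix (m n : ℕ) : Set (c ⊔ ℓ) where
    field
      lo    : Matrix m n
      hi    : Matrix m n
      lo≤hi : ∀ i j → lo i j ≤ hi i j

  _∈IM_ : ∀ {m n} → Matrix m n → IntervalMatrix m n → Set ℓ
  A ∈IM M = ∀ i j → (lo i j ≤ A i j) × (A i j ≤ hi i j)
    where open IntervalMatrix M

  IsMonge : ∀ {m n} → Matrix m n → Set ℓ
  IsMonge A = ∀ (i k : Fin _) (j l : Fin _) → i < k → j < l →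
              (A i j + A k l) ≤ (A i l + A k j)

  WeakMonge : ∀ {m n} → IntervalMatrix m n → Set (c ⊔ ℓ)
  WeakMonge M = Σ (Matrix _ _) λ A → (A ∈IM M) × IsMonge A

  RowIntersectionNonempty : ∀ {m n} → IntervalMatrix m n → Fin m → Set (c ⊔ ℓ)
  RowIntersectionNonempty M i =
    Σ Carrier λ x → ∀ j → (lo i j ≤ x) × (x ≤ hi i j)
    where open IntervalMatrix M

  ColIntersectionNonempty : ∀ {m n} → IntervalMatrix m n → Fin n → Set (c ⊔ ℓ)
  ColIntersectionNonempty M j =
    Σ Carrier λ x → ∀ i → (lo i j ≤ x) × (x ≤ hi i j)
    where open IntervalMatrix M

module Submission where

open import Defs
open import Data.Nat using (ℕ)
open import Data.Fin using (Fin)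
open import Data.Sum using (_⊎_; [_,_])
open import Data.Product using (_,_; proj₁; proj₂)
open import Relation.Binary.PropositionalEquality using (subst)
open import Relation.Binary.Structures using (IsTotalOrder)
open import Algebra.Structures using (IsAbelianGroup)

-- A matrix whose entries depend on the row only, or on the column only, satisfies every
-- Monge inequality with equality. A common point x_i of the intervals in row i (resp. y_j
-- of column j) thus gives the Monge matrix (x_i)_{ij} (resp. (y_j)_{ij}) inside M.

module _ {c ℓ} (G : OrderedAbelianGroup c ℓ) where
  open OrderedAbelianGroup G

  private
    ≤-refl : ∀ {a} → a ≤ a
    ≤-refl = IsTotalOrder.refl isTotalOrder

  rowConstant-isMonge : ∀ {m n} (f : Fin m → Carrier) → IsMonge G {m} {n} (λ i _ → f i)
  rowConstant-isMonge f i k j l _ _ = ≤-refl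

  colConstant-isMonge : ∀ {m n} (g : Fin n → Carrier) → IsMonge G {m} {n} (λ _ j → g j)
  colConstant-isMonge g i k j l _ _ =
    subst (λ z → (g j + g l) ≤ z) (IsAbelianGroup.comm isAbelianGroup (g j) (g l)) ≤-refl

  weakMonge-fromRows : ∀ {m n} (M : IntervalMatrix G m n) →
                       (∀ i → RowIntersectionNonempty G M i) → WeakMonge G M
  weakMonge-fromRows M rows =
    (λ i _ → proj₁ (rows i)) , (λ i j → proj₂ (rows i) j) , rowConstant-isMonge (λ i → proj₁ (rows i))

  weakMonge-fromCols : ∀ {m n} (M : IntervalMatrix G m n) →
                       (∀ j → ColIntersectionNonempty G M j) → WeakMonge G M
  weakMonge-fromCols M cols =
    (λ _ j → proj₁ (cols j)) , (λ i j → proj₂ (cols j) i) , colConstant-isMonge (λ j → proj₁ (cols j))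

proposition4p3 : ∀ {c ℓ} (G : OrderedAbelianGroup c ℓ) (m n : ℕ) (M : IntervalMatrix G m n) →
    ((∀ i → RowIntersectionNonempty G M i) ⊎ (∀ j → ColIntersectionNonempty G M j)) →
    WeakMonge G M
proposition4p3 G m n M = [ weakMonge-fromRows G M , weakMonge-fromCols G M ]
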